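{- Let $a,c$ be elements of a finite co-Heyting algebra $L$ with $c\ll a$ and $a\neq\mathbf 0$. Then there exist a finite co-Heyting algebra $L'$ containing $L$ as a subalgebra and a non-zero element $b\in L'$ such that $c\ll b\ll a$ in $L'$.
   Context: A co-Heyting algebra is a bounded distributive lattice $(L,\mathbf{0},\mathbf{1},\vee,\wedge)$ with a binary operation $-$ such that $a-b$ is the least $c\in L$ with $a\le b\vee c$; subalgebras are in the language $\{\mathbf 0,\mathbf 1,\vee,\wedge,-\}$. For $a,b$ write $b\ll a$ iff $a-b=a$ and $b\le a$. -}

module Defs where

open import Data.Nat using (ℕ)
open import Data.Fin using (Fin)
open import Data.Product using (Σ; _×_)
open import Function.Bundles using (_↔_)
open import Relation.Binary.PropositionalEquality using (_≡_)

record CoHeytingAlgebra : Set₁ where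
  infixr 6 _∨_
  infixr 7 _∧_
  infixl 8 _-_
  infix 4 _≤_
  field
    Carrier : Set
    𝟎 𝟏 : Carrier
    _∨_ _∧_ _-_ : Carrier → Carrier → Carrier
    ∨-assoc : ∀ x y z → (x ∨ y) ∨ z ≡ x ∨ (y ∨ z)
    ∨-comm  : ∀ x y → x ∨ y ≡ y ∨ x
    ∧-assoc : ∀ x y z → (x ∧ y) ∧ z ≡ x ∧ (y ∧ z)
    ∧-comm  : ∀ x y → x ∧ y ≡ y ∧ x
    ∨-absorbs-∧ : ∀ x y → x ∨ (x ∧ y) ≡ x
    ∧-absorbs-∨ : ∀ x y → x ∧ (x ∨ y) ≡ x
    ∧-distrib-∨ : ∀ x y z → x ∧ (y ∨ z) ≡ (x ∧ y) ∨ (x ∧ z)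
    ∨-identity : ∀ x → x ∨ 𝟎 ≡ x
    ∧-identity : ∀ x → x ∧ 𝟏 ≡ x

  _≤_ : Carrier → Carrier → Set
  x ≤ y = x ∨ y ≡ y

  field
    -‿covers : ∀ a b → a ≤ b ∨ (a - b)
    -‿least  : ∀ a b c → a ≤ b ∨ c → a - b ≤ c

  _≪_ : Carrier → Carrier → Set
  b ≪ a = (a - b ≡ a) × (b ≤ a)

open CoHeytingAlgebra public

Finite : CoHeytingAlgebra → Set
Finite L = Σ ℕ λ n → Carrier L ↔ Fin n

-- An embedding of co-Heyting algebras (exhibiting L as a subalgebra of L'):
-- an injective map preserving 𝟎, 𝟏, ∨, ∧ and -.
record Embedding (L L' : CoHeytingAlgebra) : Set where
  field
    map : Carrier L → Carrier L'
    injective : ∀ x y → map x ≡ map y → x ≡ y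
    pres-𝟎 : map (𝟎 L) ≡ 𝟎 L'
    pres-𝟏 : map (𝟏 L) ≡ 𝟏 L'
    pres-∨ : ∀ x y → map (_∨_ L x y) ≡ _∨_ L' (map x) (map y)
    pres-∧ : ∀ x y → map (_∧_ L x y) ≡ _∧_ L' (map x) (map y)
    pres-- : ∀ x y → map (_-_ L x y) ≡ _-_ L' (map x) (map y)

-- Inside L × L take the pairs (x₀ , x₁) with x₀ ∧ c ≤ x₁ ≤ x₀.  They form a
-- sublattice into which L embeds diagonally, and they are closed under the
-- difference "componentwise difference, then the least admissible pair above
-- it", which makes them a co-Heyting algebra L'.  The pair b = (a , c) lies
-- between the images of c and a, and both b - c = b and a - b = a in L' reduce
-- to a - c = a in L.
module Submission where

open import Algebra.Consequences.Propositional using (comm∧distrˡ⇒distrʳ)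
import Algebra.Lattice.Bundles as Alg
import Algebra.Lattice.Properties.Lattice as AlgLatticeProperties
open import Axiom.UniquenessOfIdentityProofs using (module Decidable⇒UIP)
open import Data.Bool using (if_then_else_)
open import Data.Fin using (Fin; zero; suc)
open import Data.Fin.Properties using (+↔⊎; *↔×) renaming (_≟_ to _≟ᶠ_)
open import Data.Nat using (zero; suc; _*_)
open import Data.Product using (Σ; ∃; _×_; _,_; proj₂)
open import Data.Product.Function.Dependent.Propositional using (Σ-↔)
open import Data.Product.Function.NonDependent.Propositional using (_×-↔_)
open import Data.Sum using (_⊎_; inj₁; inj₂)
open import Data.Sum.Function.Propositional using (_⊎-↔_)
open import Function using (_∘_)
open import Function.Bundles using (_↔_; Inverse; mk↔ₛ′)
open import Function.Construct.Composition using (_↔-∘_)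
open import Function.Construct.Identity using (↔-id)
open import Function.Construct.Symmetry using (↔-sym)
open import Function.Properties.Inverse using (↔⇒↣)
open import Relation.Binary.Definitions using (DecidableEquality)
import Relation.Binary.Lattice as Ord
import Relation.Binary.Lattice.Properties.JoinSemilattice as JoinProperties
import Relation.Binary.Lattice.Properties.MeetSemilattice as MeetProperties
open import Relation.Binary.PropositionalEquality
open import Relation.Nullary using (¬_; Dec; yes; no; does; _×-dec_; contradiction)
open import Relation.Nullary.Decidable using (via-injection)
open import Relation.Nullary.Irrelevant using (Irrelevant)
open import Relation.Unary using (Decidable)

open import Defs using (CoHeytingAlgebra; Finite; Embedding)

Irrelevant↔Fin : {A : Set} → Irrelevant A → (a? : Dec A) → A ↔ Fin (if does a? then 1 else 0)
Irrelevant↔Fin irr (yes a) = mk↔ₛ′ (λ _ → zero) (λ _ → a) (λ { zero → refl }) (irr a)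
Irrelevant↔Fin irr (no ¬a) = mk↔ₛ′ (λ a → contradiction a ¬a) (λ ()) (λ ()) (λ a → contradiction a ¬a)

Σ-Fin-suc↔ : ∀ {n} {P : Fin (suc n) → Set} → Σ (Fin (suc n)) P ↔ (P zero ⊎ Σ (Fin n) (P ∘ suc))
Σ-Fin-suc↔ = mk↔ₛ′ (λ { (zero , p) → inj₁ p ; (suc i , p) → inj₂ (i , p) })
                   (λ { (inj₁ p) → zero , p ; (inj₂ (i , p)) → suc i , p })
                   (λ { (inj₁ _) → refl ; (inj₂ _) → refl })
                   (λ { (zero , _) → refl ; (suc _ , _) → refl })

Σ-Fin-finite : ∀ n {P : Fin n → Set} → Decidable P → (∀ i → Irrelevant (P i)) → ∃ λ k → Σ (Fin n) P ↔ Fin k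
Σ-Fin-finite zero P? irr = 0 , mk↔ₛ′ (λ { (() , _) }) (λ ()) (λ ()) (λ { (() , _) })
Σ-Fin-finite (suc n) P? irr =
  let _ , Σ↔Fin = Σ-Fin-finite n (P? ∘ suc) (irr ∘ suc)
  in _ , ↔-sym +↔⊎ ↔-∘ ((Irrelevant↔Fin (irr zero) (P? zero) ⊎-↔ Σ↔Fin) ↔-∘ Σ-Fin-suc↔)

Σ-finite : ∀ {A : Set} {n} {P : A → Set} → A ↔ Fin n → Decidable P → (∀ x → Irrelevant (P x)) → ∃ λ k → Σ A P ↔ Fin k
Σ-finite {n = n} A↔Fin P? irr =
  let _ , Σ↔Fin = Σ-Fin-finite n (P? ∘ from) (irr ∘ from)
  in _ , Σ↔Fin ↔-∘ ↔-sym (Σ-↔ (↔-sym A↔Fin) (↔-id _))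
  where open Inverse A↔Fin using (from)

×-self↔Fin : ∀ {A : Set} {n} → A ↔ Fin n → (A × A) ↔ Fin (n * n)
×-self↔Fin {n = n} A↔Fin = ↔-sym (*↔× {n} {n}) ↔-∘ (A↔Fin ×-↔ A↔Fin)

finite⇒decidableEquality : (L : CoHeytingAlgebra) → Finite L → DecidableEquality (CoHeytingAlgebra.Carrier L)
finite⇒decidableEquality L (_ , L↔Fin) = via-injection (↔⇒↣ L↔Fin) _≟ᶠ_

module CoHeytingProperties (L : CoHeytingAlgebra) where
  open CoHeytingAlgebra L

  lattice : Alg.Lattice _ _
  lattice = record
    { Carrier   = Carrier
    ; _≈_       = _≡_
    ; _∨_       = _∨_
    ; _∧_       = _∧_
    ; isLattice = record
      { isEquivalence = isEquivalence
      ; ∨-comm        = ∨-comm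
      ; ∨-assoc       = ∨-assoc
      ; ∨-cong        = cong₂ _∨_
      ; ∧-comm        = ∧-comm
      ; ∧-assoc       = ∧-assoc
      ; ∧-cong        = cong₂ _∧_
      ; absorptive    = ∨-absorbs-∧ , ∧-absorbs-∨
      }
    }

  open AlgLatticeProperties lattice public using (∨-idem)
  private
    module ⊑ = Ord.Lattice (AlgLatticeProperties.∨-∧-orderTheoreticLattice lattice)
    module ⊑∨ = JoinProperties ⊑.joinSemilattice
    module ⊑∧ = MeetProperties ⊑.meetSemilattice

  -- The library orders a lattice by x ≡ x ∧ y; the order of L is x ∨ y ≡ y.
  ≤⇒⊑ : ∀ {x y} → x ≤ y → x ⊑.≤ y
  ≤⇒⊑ {x} {y} x≤y = sym (trans (cong (x ∧_) (sym x≤y)) (∧-absorbs-∨ x y))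

  ⊑⇒≤ : ∀ {x y} → x ⊑.≤ y → x ≤ y
  ⊑⇒≤ {x} {y} x⊑y = begin
    x ∨ y        ≡⟨ cong (_∨ y) x⊑y ⟩
    x ∧ y ∨ y    ≡⟨ ∨-comm (x ∧ y) y ⟩
    y ∨ x ∧ y    ≡⟨ cong (y ∨_) (∧-comm x y) ⟩
    y ∨ y ∧ x    ≡⟨ ∨-absorbs-∧ y x ⟩
    y            ∎
    where open ≡-Reasoning

  ≤-refl : ∀ {x} → x ≤ x
  ≤-refl = ⊑⇒≤ ⊑.refl

  ≤-trans : ∀ {x y z} → x ≤ y → y ≤ z → x ≤ z
  ≤-trans x≤y y≤z = ⊑⇒≤ (⊑.trans (≤⇒⊑ x≤y) (≤⇒⊑ y≤z))

  ≤-antisym : ∀ {x y} → x ≤ y → y ≤ x → x ≡ y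
  ≤-antisym x≤y y≤x = ⊑.antisym (≤⇒⊑ x≤y) (≤⇒⊑ y≤x)

  x≤x∨y : ∀ x y → x ≤ x ∨ y
  x≤x∨y x y = ⊑⇒≤ (⊑.x≤x∨y x y)

  y≤x∨y : ∀ x y → y ≤ x ∨ y
  y≤x∨y x y = ⊑⇒≤ (⊑.y≤x∨y x y)

  ∨-least : ∀ {x y z} → x ≤ z → y ≤ z → x ∨ y ≤ z
  ∨-least x≤z y≤z = ⊑⇒≤ (⊑.∨-least (≤⇒⊑ x≤z) (≤⇒⊑ y≤z))

  x∧y≤x : ∀ x y → x ∧ y ≤ x
  x∧y≤x x y = ⊑⇒≤ (⊑.x∧y≤x x y)

  x∧y≤y : ∀ x y → x ∧ y ≤ y
  x∧y≤y x y = ⊑⇒≤ (⊑.x∧y≤y x y)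

  ∧-greatest : ∀ {x y z} → z ≤ x → z ≤ y → z ≤ x ∧ y
  ∧-greatest z≤x z≤y = ⊑⇒≤ (⊑.∧-greatest (≤⇒⊑ z≤x) (≤⇒⊑ z≤y))

  ∨-monotonic : ∀ {x y u v} → x ≤ y → u ≤ v → x ∨ u ≤ y ∨ v
  ∨-monotonic x≤y u≤v = ⊑⇒≤ (⊑∨.∨-monotonic (≤⇒⊑ x≤y) (≤⇒⊑ u≤v))

  ∧-monotonic : ∀ {x y u v} → x ≤ y → u ≤ v → x ∧ u ≤ y ∧ v
  ∧-monotonic x≤y u≤v = ⊑⇒≤ (⊑∧.∧-monotonic (≤⇒⊑ x≤y) (≤⇒⊑ u≤v))

  x≤y⇒x∧y≡x : ∀ {x y} → x ≤ y → x ∧ y ≡ x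
  x≤y⇒x∧y≡x = sym ∘ ≤⇒⊑

  𝟎≤ : ∀ x → 𝟎 ≤ x
  𝟎≤ x = trans (∨-comm 𝟎 x) (∨-identity x)

  ∧-distribʳ-∨ : ∀ x y z → (y ∨ z) ∧ x ≡ y ∧ x ∨ z ∧ x
  ∧-distribʳ-∨ = comm∧distrˡ⇒distrʳ ∧-comm ∧-distrib-∨

  x-x≡𝟎 : ∀ x → x - x ≡ 𝟎
  x-x≡𝟎 x = ≤-antisym (-‿least x x 𝟎 (x≤x∨y x 𝟎)) (𝟎≤ (x - x))

module PairAlgebra (L : CoHeytingAlgebra) (_≟_ : DecidableEquality (CoHeytingAlgebra.Carrier L))
             (c : CoHeytingAlgebra.Carrier L) where
  open CoHeytingAlgebra L
  open CoHeytingProperties L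

  Admissible : Carrier × Carrier → Set
  Admissible (x₀ , x₁) = x₀ ∧ c ≤ x₁ × x₁ ≤ x₀

  Elem : Set
  Elem = Σ (Carrier × Carrier) Admissible

  hi lo : Elem → Carrier
  hi ((x₀ , _) , _) = x₀
  lo ((_ , x₁) , _) = x₁

  hi∧c≤lo : ∀ x → hi x ∧ c ≤ lo x
  hi∧c≤lo (_ , x₀∧c≤x₁ , _) = x₀∧c≤x₁

  lo≤hi : ∀ x → lo x ≤ hi x
  lo≤hi (_ , _ , x₁≤x₀) = x₁≤x₀

  admissible? : Decidable Admissible
  admissible? (x₀ , x₁) = ((x₀ ∧ c ∨ x₁) ≟ x₁) ×-dec ((x₁ ∨ x₀) ≟ x₀)

  admissible-irrelevant : ∀ p → Irrelevant (Admissible p)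
  admissible-irrelevant _ (p , q) (p′ , q′) = cong₂ _,_ (≡-irrelevant p p′) (≡-irrelevant q q′)
    where open Decidable⇒UIP _≟_

  Elem-≡ : ∀ {x y : Elem} → hi x ≡ hi y → lo x ≡ lo y → x ≡ y
  Elem-≡ {(_ , p)} {(_ , q)} refl refl = cong (_ ,_) (admissible-irrelevant _ p q)

  diagonal : Carrier → Elem
  diagonal x = (x , x) , x∧y≤x x c , ≤-refl

  𝟎ᵉ 𝟏ᵉ : Elem
  𝟎ᵉ = diagonal 𝟎
  𝟏ᵉ = diagonal 𝟏

  _∨ᵉ_ _∧ᵉ_ : Elem → Elem → Elem
  x ∨ᵉ y = (hi x ∨ hi y , lo x ∨ lo y) , hi∧c≤lo′ , ∨-monotonic (lo≤hi x) (lo≤hi y)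
    where
    hi∧c≤lo′ : (hi x ∨ hi y) ∧ c ≤ lo x ∨ lo y
    hi∧c≤lo′ = subst (_≤ lo x ∨ lo y) (sym (∧-distribʳ-∨ c (hi x) (hi y)))
                     (∨-monotonic (hi∧c≤lo x) (hi∧c≤lo y))
  x ∧ᵉ y = (hi x ∧ hi y , lo x ∧ lo y) , hi∧c≤lo′ , ∧-monotonic (lo≤hi x) (lo≤hi y)
    where
    hi∧c≤lo′ : (hi x ∧ hi y) ∧ c ≤ lo x ∧ lo y
    hi∧c≤lo′ = ∧-greatest (≤-trans (∧-monotonic (x∧y≤x _ _) ≤-refl) (hi∧c≤lo x))
                          (≤-trans (∧-monotonic (x∧y≤y _ _) ≤-refl) (hi∧c≤lo y))

  closure : Carrier → Carrier → Elem
  closure d₀ d₁ = (d₀ ∨ d₁ , d₁ ∨ d₀ ∧ c) , hi∧c≤lo′ , lo≤hi′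
    where
    lo≤hi′ : d₁ ∨ d₀ ∧ c ≤ d₀ ∨ d₁
    lo≤hi′ = ∨-least (y≤x∨y d₀ d₁) (≤-trans (x∧y≤x d₀ c) (x≤x∨y d₀ d₁))
    hi∧c≤lo′ : (d₀ ∨ d₁) ∧ c ≤ d₁ ∨ d₀ ∧ c
    hi∧c≤lo′ = subst (_≤ d₁ ∨ d₀ ∧ c) (sym (∧-distribʳ-∨ c d₀ d₁))
                     (∨-least (y≤x∨y d₁ (d₀ ∧ c)) (≤-trans (x∧y≤x d₁ c) (x≤x∨y d₁ (d₀ ∧ c))))

  closure-least : ∀ {d₀ d₁} z → d₀ ≤ hi z → d₁ ≤ lo z → closure d₀ d₁ ∨ᵉ z ≡ z
  closure-least z d₀≤ d₁≤ =
    Elem-≡ (∨-least d₀≤ (≤-trans d₁≤ (lo≤hi z)))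
           (∨-least d₁≤ (≤-trans (∧-monotonic d₀≤ ≤-refl) (hi∧c≤lo z)))

  _-ᵉ_ : Elem → Elem → Elem
  x -ᵉ y = closure (hi x - hi y) (lo x - lo y)

  algebra : CoHeytingAlgebra
  algebra = record
    { Carrier     = Elem
    ; 𝟎           = 𝟎ᵉ
    ; 𝟏           = 𝟏ᵉ
    ; _∨_         = _∨ᵉ_
    ; _∧_         = _∧ᵉ_
    ; _-_         = _-ᵉ_
    ; ∨-assoc     = λ _ _ _ → Elem-≡ (∨-assoc _ _ _) (∨-assoc _ _ _)
    ; ∨-comm      = λ _ _ → Elem-≡ (∨-comm _ _) (∨-comm _ _)
    ; ∧-assoc     = λ _ _ _ → Elem-≡ (∧-assoc _ _ _) (∧-assoc _ _ _)
    ; ∧-comm      = λ _ _ → Elem-≡ (∧-comm _ _) (∧-comm _ _)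
    ; ∨-absorbs-∧ = λ _ _ → Elem-≡ (∨-absorbs-∧ _ _) (∨-absorbs-∧ _ _)
    ; ∧-absorbs-∨ = λ _ _ → Elem-≡ (∧-absorbs-∨ _ _) (∧-absorbs-∨ _ _)
    ; ∧-distrib-∨ = λ _ _ _ → Elem-≡ (∧-distrib-∨ _ _ _) (∧-distrib-∨ _ _ _)
    ; ∨-identity  = λ _ → Elem-≡ (∨-identity _) (∨-identity _)
    ; ∧-identity  = λ _ → Elem-≡ (∧-identity _) (∧-identity _)
    ; -‿covers    = λ x y →
        Elem-≡ (≤-trans (-‿covers (hi x) (hi y)) (∨-monotonic ≤-refl (x≤x∨y _ _)))
               (≤-trans (-‿covers (lo x) (lo y)) (∨-monotonic ≤-refl (x≤x∨y _ _)))
    ; -‿least     = λ x y z x≤y∨z →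
        closure-least z (-‿least (hi x) (hi y) (hi z) (cong hi x≤y∨z))
                        (-‿least (lo x) (lo y) (lo z) (cong lo x≤y∨z))
    }

  finite : Finite L → Finite algebra
  finite (_ , L↔Fin) = Σ-finite (×-self↔Fin L↔Fin) admissible? admissible-irrelevant

  embedding : Embedding L algebra
  embedding = record
    { map       = diagonal
    ; injective = λ _ _ → cong hi
    ; pres-𝟎    = refl
    ; pres-𝟏    = refl
    ; pres-∨    = λ _ _ → Elem-≡ refl refl
    ; pres-∧    = λ _ _ → Elem-≡ refl refl
    ; pres--    = λ x y → Elem-≡ (sym (∨-idem (x - y))) (sym (∨-absorbs-∧ (x - y) c))
    }

  _≪ᵉ_ : Elem → Elem → Set
  _≪ᵉ_ = CoHeytingAlgebra._≪_ algebra

  between : ∀ {a} → c ≤ a → Elem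
  between {a} c≤a = (a , c) , x∧y≤y a c , c≤a

  between-≢-𝟎 : ∀ {a} (c≤a : c ≤ a) → ¬ (a ≡ 𝟎) → ¬ (between c≤a ≡ 𝟎ᵉ)
  between-≢-𝟎 _ a≢𝟎 = a≢𝟎 ∘ cong hi

  diagonal-≪-between : ∀ {a} (c≪a : c ≪ a) → diagonal c ≪ᵉ between (proj₂ c≪a)
  diagonal-≪-between {a} (a-c≡a , c≤a) = Elem-≡ hi-eq lo-eq , Elem-≡ c≤a (∨-idem c)
    where
    open ≡-Reasoning
    hi-eq : (a - c) ∨ (c - c) ≡ a
    hi-eq = begin
      (a - c) ∨ (c - c)   ≡⟨ cong₂ _∨_ a-c≡a (x-x≡𝟎 c) ⟩
      a ∨ 𝟎               ≡⟨ ∨-identity a ⟩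
      a                   ∎
    lo-eq : (c - c) ∨ (a - c) ∧ c ≡ c
    lo-eq = begin
      (c - c) ∨ (a - c) ∧ c   ≡⟨ cong₂ _∨_ (x-x≡𝟎 c) (cong (_∧ c) a-c≡a) ⟩
      𝟎 ∨ a ∧ c               ≡⟨ 𝟎≤ (a ∧ c) ⟩
      a ∧ c                   ≡⟨ ∧-comm a c ⟩
      c ∧ a                   ≡⟨ x≤y⇒x∧y≡x c≤a ⟩
      c                       ∎

  between-≪-diagonal : ∀ {a} (c≪a : c ≪ a) → between (proj₂ c≪a) ≪ᵉ diagonal a
  between-≪-diagonal {a} (a-c≡a , c≤a) = Elem-≡ hi-eq lo-eq , Elem-≡ (∨-idem a) c≤a
    where
    open ≡-Reasoning
    hi-eq : (a - a) ∨ (a - c) ≡ a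
    hi-eq = begin
      (a - a) ∨ (a - c)   ≡⟨ cong₂ _∨_ (x-x≡𝟎 a) a-c≡a ⟩
      𝟎 ∨ a               ≡⟨ 𝟎≤ a ⟩
      a                   ∎
    lo-eq : (a - c) ∨ (a - a) ∧ c ≡ a
    lo-eq = begin
      (a - c) ∨ (a - a) ∧ c   ≡⟨ cong₂ _∨_ a-c≡a (cong (_∧ c) (x-x≡𝟎 a)) ⟩
      a ∨ 𝟎 ∧ c               ≡⟨ cong (a ∨_) (x≤y⇒x∧y≡x (𝟎≤ c)) ⟩
      a ∨ 𝟎                   ≡⟨ ∨-identity a ⟩
      a                       ∎

open CoHeytingAlgebra using (Carrier; 𝟎; _≪_)

lemma4p1 : (L : CoHeytingAlgebra) → Finite L → (a c : Carrier L) → _≪_ L c a → ¬ (a ≡ 𝟎 L) → Σ CoHeytingAlgebra λ L' → Finite L' × Σ (Embedding L L') λ e → Σ (Carrier L') λ b → ¬ (b ≡ 𝟎 L') × _≪_ L' (Embedding.map e c) b × _≪_ L' b (Embedding.map e a)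
lemma4p1 L fin a c c≪a@(_ , c≤a) a≢𝟎 =
  algebra , finite fin , embedding , between c≤a ,
  between-≢-𝟎 c≤a a≢𝟎 , diagonal-≪-between c≪a , between-≪-diagonal c≪a
  where open PairAlgebra L (finite⇒decidableEquality L fin) c
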